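{- There is no regular total ordering $<$ of $Sen(L)$ which is $\wedge$-monotonic, and no regular total ordering of $Sen(L)$ which is $\vee$-monotonic. Consequently there is no nonempty $X\subseteq Reg^*$ such that the scheme $\varphi\wedge(\psi|\sigma)\leftrightarrow(\varphi\wedge\psi)|(\varphi\wedge\sigma)$ is a $\models_X$-tautology, and no nonempty $X\subseteq Reg^*$ such that the scheme $\varphi\vee(\psi|\sigma)\leftrightarrow(\varphi\vee\psi)|(\varphi\vee\sigma)$ is a $\models_X$-tautology.
   Context: $L$ is the propositional language with atoms $p_0,p_1,\ldots$ and connectives $\neg,\wedge$ (others defined); $L_s$ adds a primitive binary connective $|$. $\sim$ is classical equivalence on $Sen(L)$, $[\alpha]=\{\beta:\beta\sim\alpha\}$. A total ordering $<$ of $Sen(L)$ is regular if $\alpha\not\sim\beta$ and $\alpha<\beta$ imply $\alpha'<\beta'$ for all $\alpha'\in[\alpha],\beta'\in[\beta]$. A regular total ordering is $\wedge$-monotonic if for all $\alpha,\beta,\gamma$ with $\alpha\wedge\gamma\not\sim\beta\wedge\gamma$: $\alpha<\beta\iff\alpha\wedge\gamma<\beta\wedge\gamma$; it is $\vee$-monotonic if for all $\alpha,\beta,\gamma$ with $\alpha\vee\gamma\not\sim\beta\vee\gamma$: $\alpha<\beta\iff\alpha\vee\gamma<\beta\vee\gamma$. A choice function for $L$ is a map $f$ with $f(\alpha,\beta)=f(\{\alpha,\beta\})\in\{\alpha,\beta\}$ for all $\alpha,\beta\in Sen(L)$; $Reg^*$ is the set of choice functions of the form $f=\min_<$ for a regular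 total ordering $<$ of $Sen(L)$. Each $f$ induces $\overline f:Sen(L_s)\to Sen(L)$: identity on $Sen(L)$, commuting with $\neg,\wedge$, and $\overline f(\varphi|\psi)=f(\overline f(\varphi),\overline f(\psi))$. For a truth assignment $M$ of $Sen(L)$, $\langle M,f\rangle\models_s\varphi$ iff $M\models\overline f(\varphi)$. A sentence is a $\models_X$-tautology if it holds in $\langle M,f\rangle$ for every $M$ and every $f\in X$; a scheme is a $\models_X$-tautology if all its instances (with $\varphi,\psi,\sigma\in Sen(L_s)$) are. -}

module Defs where

open import Data.Nat using (ℕ)
open import Data.Bool using (Bool; true; false; not; _∧_)
open import Data.Product using (Σ; ∃; _×_; _,_)
open import Data.Sum using (_⊎_)
open import Relation.Binary.PropositionalEquality using (_≡_)
open import Relation.Binary.Core using (Rel)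
open import Relation.Binary.Structures using (IsStrictTotalOrder)
open import Relation.Binary.Definitions using (tri<; tri≈; tri>)
open import Relation.Nullary using (¬_)
open import Function.Bundles using (_⇔_)

data Sen : Set where
  atom : ℕ → Sen
  ¬'_  : Sen → Sen
  _∧'_ : Sen → Sen → Sen

_∨'_ : Sen → Sen → Sen
α ∨' β = ¬' ((¬' α) ∧' (¬' β))

Assignment : Set
Assignment = ℕ → Bool

⟦_⟧ : Sen → Assignment → Bool
⟦ atom n ⟧ M = M n
⟦ ¬' α ⟧ M = not (⟦ α ⟧ M)
⟦ α ∧' β ⟧ M = ⟦ α ⟧ M ∧ ⟦ β ⟧ M

_∼_ : Sen → Sen → Set
α ∼ β = ∀ (M : Assignment) → ⟦ α ⟧ M ≡ ⟦ β ⟧ M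

_≁_ : Sen → Sen → Set
α ≁ β = ¬ (α ∼ β)

IsTotalOrdering : Rel Sen _ → Set
IsTotalOrdering _<_ = IsStrictTotalOrder _≡_ _<_

Regular : Rel Sen _ → Set
Regular _<_ = ∀ α β → α ≁ β → α < β → ∀ α' β' → α' ∼ α → β' ∼ β → α' < β'

∧-Monotonic : Rel Sen _ → Set
∧-Monotonic _<_ = ∀ α β γ → (α ∧' γ) ≁ (β ∧' γ) → (α < β) ⇔ ((α ∧' γ) < (β ∧' γ))

∨-Monotonic : Rel Sen _ → Set
∨-Monotonic _<_ = ∀ α β γ → (α ∨' γ) ≁ (β ∨' γ) → (α < β) ⇔ ((α ∨' γ) < (β ∨' γ))

-- Choice functions: f(α,β) = f({α,β}) ∈ {α,β}

record ChoiceFn : Set where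
  field
    fn     : Sen → Sen → Sen
    choice : ∀ α β → (fn α β ≡ α) ⊎ (fn α β ≡ β)
    sym    : ∀ α β → fn α β ≡ fn β α
open ChoiceFn public

min< : {_<_ : Rel Sen _} → IsTotalOrdering _<_ → Sen → Sen → Sen
min< sto α β with IsStrictTotalOrder.compare sto α β
... | tri< _ _ _ = α
... | tri≈ _ _ _ = α
... | tri> _ _ _ = β

InReg* : ChoiceFn → Set₁
InReg* f = Σ (Rel Sen _) λ _<_ → Σ (IsTotalOrdering _<_) λ sto →
             Regular _<_ × (∀ α β → fn f α β ≡ min< sto α β)

data SenS : Set where
  atom : ℕ → SenS
  ¬'_  : SenS → SenS
  _∧'_ : SenS → SenS → SenS
  _∣_  : SenS → SenS → SenS

_∨s_ : SenS → SenS → SenS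
φ ∨s ψ = ¬' ((¬' φ) ∧' (¬' ψ))

_→s_ : SenS → SenS → SenS
φ →s ψ = ¬' (φ ∧' (¬' ψ))

_↔s_ : SenS → SenS → SenS
φ ↔s ψ = (φ →s ψ) ∧' (ψ →s φ)

bar : ChoiceFn → SenS → Sen
bar f (atom n) = atom n
bar f (¬' φ) = ¬' (bar f φ)
bar f (φ ∧' ψ) = bar f φ ∧' bar f ψ
bar f (φ ∣ ψ) = fn f (bar f φ) (bar f ψ)

_,_⊨ₛ_ : Assignment → ChoiceFn → SenS → Set
M , f ⊨ₛ φ = ⟦ bar f φ ⟧ M ≡ true

TautX : (ChoiceFn → Set₁) → SenS → Set₁
TautX X φ = ∀ (M : Assignment) (f : ChoiceFn) → X f → M , f ⊨ₛ φ

SchemeTautX : (ChoiceFn → Set₁) → (SenS → SenS → SenS → SenS) → Set₁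
SchemeTautX X S = ∀ φ ψ σ → TautX X (S φ ψ σ)

NonemptySubReg* : (ChoiceFn → Set₁) → Set₁
NonemptySubReg* X = (∃ λ f → X f) × (∀ f → X f → InReg* f)

∧-distScheme : SenS → SenS → SenS → SenS
∧-distScheme φ ψ σ = (φ ∧' (ψ ∣ σ)) ↔s ((φ ∧' ψ) ∣ (φ ∧' σ))

∨-distScheme : SenS → SenS → SenS → SenS
∨-distScheme φ ψ σ = (φ ∨s (ψ ∣ σ)) ↔s ((φ ∨s ψ) ∣ (φ ∨s σ))

{-# OPTIONS --safe #-}
module Submission where

open import Defs hiding (sym)
open import Data.Product using (Σ; _×_; _,_)
open import Relation.Binary.Core using (Rel)
open import Relation.Nullary using (¬_)
open import Data.Bool using (Bool; true; false; not; _∧_)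
open import Data.Bool.Properties using (∧-identityʳ; ∧-zeroʳ; not-involutive)
open import Data.Sum using (_⊎_; inj₁; inj₂)
open import Data.Empty using (⊥; ⊥-elim)
open import Relation.Binary.PropositionalEquality
  using (_≡_; _≢_; refl; sym; trans; cong; cong₂; subst₂; module ≡-Reasoning)
open import Relation.Binary.Structures using (IsStrictTotalOrder)
open import Relation.Binary.Definitions using (tri<; tri≈; tri>)
open import Function.Bundles using (Equivalence)

-- Let op x d behave like x where d holds and ignore x where d fails (e.g.
-- x ∧ d), and suppose op preserves < whenever its results are inequivalent.
-- Relative to p ↔ ¬q, p agrees with ¬q and ¬p with q; relative to p ↔ q,
-- p agrees with q and ¬p with ¬q. Whichever way p, ¬p and q, ¬q are ordered,
-- for one of these d the pairs cross: a < b and a' < b' with op a d ∼ op b' d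
-- and op b d ∼ op a' d, so regularity turns op a' d < op b' d into
-- op b d < op a d, against op a d < op b d. Both monotonicity conditions, and
-- both distribution schemes for f = min<, yield such an op.

≡⇒∼ : ∀ {α β} → α ≡ β → α ∼ β
≡⇒∼ refl M = refl

record _∼[_]_ (α δ β : Sen) : Set where
  constructor agree-where
  field agree : ∀ M → ⟦ δ ⟧ M ≡ true → ⟦ α ⟧ M ≡ ⟦ β ⟧ M
open _∼[_]_

¬-∼[] : ∀ {α δ β} → α ∼[ δ ] β → (¬' α) ∼[ δ ] (¬' β)
¬-∼[] α∼β = agree-where λ M δM → cong not (agree α∼β M δM)

¬-∼[]-¬ : ∀ {α δ β} → α ∼[ δ ] (¬' β) → (¬' α) ∼[ δ ] β
¬-∼[]-¬ {β = β} α∼¬β = agree-where λ M δM →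
  trans (agree (¬-∼[] α∼¬β) M δM) (not-involutive (⟦ β ⟧ M))

_↔'_ : Sen → Sen → Sen
α ↔' β = (¬' (α ∧' (¬' β))) ∧' (¬' (β ∧' (¬' α)))

↔'-sound : ∀ α β M → ⟦ α ↔' β ⟧ M ≡ true → ⟦ α ⟧ M ≡ ⟦ β ⟧ M
↔'-sound α β M = iff-true (⟦ α ⟧ M) (⟦ β ⟧ M)
  where
  iff-true : ∀ a b → not (a ∧ not b) ∧ not (b ∧ not a) ≡ true → a ≡ b
  iff-true true  true  _ = refl
  iff-true false false _ = refl

↔'-∼[] : ∀ α β → α ∼[ α ↔' β ] β
↔'-∼[] α β = agree-where (↔'-sound α β)

record Relativisation (op : Sen → Sen → Sen) : Set where
  field
    truth       : Bool → Bool → Bool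
    ⟦op⟧        : ∀ x d M → ⟦ op x d ⟧ M ≡ truth (⟦ x ⟧ M) (⟦ d ⟧ M)
    truth-true  : ∀ a → truth a true ≡ a
    truth-false : ∀ a b → truth a false ≡ truth b false

  where-true : ∀ x d M → ⟦ d ⟧ M ≡ true → ⟦ op x d ⟧ M ≡ ⟦ x ⟧ M
  where-true x d M dM = trans (⟦op⟧ x d M) (trans (cong (truth _) dM) (truth-true _))

  where-false : ∀ x y d M → ⟦ d ⟧ M ≡ false → ⟦ op x d ⟧ M ≡ ⟦ op y d ⟧ M
  where-false x y d M dM = begin
    ⟦ op x d ⟧ M                ≡⟨ ⟦op⟧ x d M ⟩
    truth (⟦ x ⟧ M) (⟦ d ⟧ M)   ≡⟨ cong (truth _) dM ⟩
    truth (⟦ x ⟧ M) false       ≡⟨ truth-false _ _ ⟩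
    truth (⟦ y ⟧ M) false       ≡⟨ cong (truth _) dM ⟨
    truth (⟦ y ⟧ M) (⟦ d ⟧ M)   ≡⟨ ⟦op⟧ y d M ⟨
    ⟦ op y d ⟧ M                ∎
    where open ≡-Reasoning

  op-∼ : ∀ {x y d} → x ∼[ d ] y → op x d ∼ op y d
  op-∼ {x} {y} {d} x∼y M with ⟦ d ⟧ M in dM
  ... | true  = trans (where-true x d M dM) (trans (agree x∼y M dM) (sym (where-true y d M dM)))
  ... | false = where-false x y d M dM

  op-≁ : ∀ {x y d} M → ⟦ d ⟧ M ≡ true → ⟦ x ⟧ M ≢ ⟦ y ⟧ M → op x d ≁ op y d
  op-≁ {x} {y} {d} M dM x≢y opx∼opy =
    x≢y (trans (sym (where-true x d M dM)) (trans (opx∼opy M) (where-true y d M dM)))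

Monotone : (Sen → Sen → Sen) → Rel Sen _ → Set
Monotone op _<_ = ∀ x y d → op x d ≁ op y d → x < y → op x d < op y d

module _ {op : Sen → Sen → Sen} (rel : Relativisation op)
         {_<_ : Rel Sen _} (sto : IsTotalOrdering _<_) (reg : Regular _<_)
         (mono : Monotone op _<_) where

  open Relativisation rel
  open IsStrictTotalOrder sto using (compare; asym)

  private
    crossing : ∀ {a b a' b'} d M → ⟦ d ⟧ M ≡ true → ⟦ a ⟧ M ≢ ⟦ b ⟧ M →
               a ∼[ d ] b' → b ∼[ d ] a' → a < b → a' < b' → ⊥
    crossing {a} {b} {a'} {b'} d M dM a≢b a∼b' b∼a' a<b a'<b' =
      asym (mono a b d opa≁opb a<b)
           (reg _ _ opa'≁opb' (mono a' b' d opa'≁opb' a'<b') _ _ (op-∼ b∼a') (op-∼ a∼b'))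
      where
      opa≁opb : op a d ≁ op b d
      opa≁opb = op-≁ M dM a≢b
      opa'≁opb' : op a' d ≁ op b' d
      opa'≁opb' = op-≁ M dM λ a'≡b' →
        a≢b (trans (agree a∼b' M dM) (trans (sym a'≡b') (sym (agree b∼a' M dM))))

    p q : Sen
    p = atom 0
    q = atom 1

    p-false-q : Assignment
    p-false-q 0 = true
    p-false-q _ = false

    all-true : Assignment
    all-true _ = true

    atom-vs-¬ : ∀ n → atom n < (¬' atom n) ⊎ (¬' atom n) < atom n
    atom-vs-¬ n with compare (atom n) (¬' atom n)
    ... | tri< lt _ _ = inj₁ lt
    ... | tri≈ _ () _
    ... | tri> _ _ gt = inj₂ gt

  no-regular-monotone-order : ⊥
  no-regular-monotone-order with atom-vs-¬ 0 | atom-vs-¬ 1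
  ... | inj₁ p<¬p | inj₁ q<¬q =
    crossing (p ↔' (¬' q)) p-false-q refl (λ ()) (↔'-∼[] p (¬' q)) (¬-∼[]-¬ (↔'-∼[] p (¬' q))) p<¬p q<¬q
  ... | inj₁ p<¬p | inj₂ ¬q<q =
    crossing (p ↔' q) all-true refl (λ ()) (↔'-∼[] p q) (¬-∼[] (↔'-∼[] p q)) p<¬p ¬q<q
  ... | inj₂ ¬p<p | inj₁ q<¬q =
    crossing (p ↔' q) all-true refl (λ ()) (¬-∼[] (↔'-∼[] p q)) (↔'-∼[] p q) ¬p<p q<¬q
  ... | inj₂ ¬p<p | inj₂ ¬q<q =
    crossing (p ↔' (¬' q)) p-false-q refl (λ ()) (¬-∼[]-¬ (↔'-∼[] p (¬' q))) (↔'-∼[] p (¬' q)) ¬p<p ¬q<q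

∧-relativisation : Relativisation (λ x d → x ∧' d)
∧-relativisation = record
  { truth = _∧_ ; ⟦op⟧ = λ _ _ _ → refl
  ; truth-true = ∧-identityʳ ; truth-false = λ a b → trans (∧-zeroʳ a) (sym (∧-zeroʳ b)) }

∧-relativisationˡ : Relativisation (λ x d → d ∧' x)
∧-relativisationˡ = record
  { truth = λ a b → b ∧ a ; ⟦op⟧ = λ _ _ _ → refl
  ; truth-true = λ _ → refl ; truth-false = λ _ _ → refl }

∨¬-relativisation : Relativisation (λ x d → x ∨' (¬' d))
∨¬-relativisation = record
  { truth = λ a b → not (not a ∧ not (not b)) ; ⟦op⟧ = λ _ _ _ → refl
  ; truth-true = λ { true → refl ; false → refl }
  ; truth-false = λ { true true → refl ; true false → refl ; false true → refl ; false false → refl } }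

∨¬-relativisationˡ : Relativisation (λ x d → (¬' d) ∨' x)
∨¬-relativisationˡ = record
  { truth = λ a b → not (not (not b) ∧ not a) ; ⟦op⟧ = λ _ _ _ → refl
  ; truth-true = λ { true → refl ; false → refl } ; truth-false = λ _ _ → refl }

module _ {_<_ : Rel Sen _} (sto : IsTotalOrdering _<_) where

  open IsStrictTotalOrder sto using (compare)

  min<-< : ∀ {α β} → α < β → min< sto α β ≡ α
  min<-< {α} {β} α<β with compare α β
  ... | tri< _ _ _   = refl
  ... | tri≈ _ _ _   = refl
  ... | tri> α≮β _ _ = ⊥-elim (α≮β α<β)

  ∼min<⇒< : ∀ {α β} → α ≁ β → α ∼ min< sto α β → α < β
  ∼min<⇒< {α} {β} α≁β α∼min with compare α β
  ... | tri< α<β _ _ = α<β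
  ... | tri≈ _ α≡β _ = ⊥-elim (α≁β (≡⇒∼ α≡β))
  ... | tri> _ _ _   = ⊥-elim (α≁β α∼min)

  commutes-with-min⇒Monotone : ∀ {op} →
    (∀ x y d → op (min< sto x y) d ∼ min< sto (op x d) (op y d)) → Monotone op _<_
  commutes-with-min⇒Monotone {op} commute x y d opx≁opy x<y =
    ∼min<⇒< opx≁opy λ M → trans (cong (λ z → ⟦ op z d ⟧ M) (sym (min<-< x<y))) (commute x y d M)

no-Reg*-choice-commutes : ∀ {op} → Relativisation op → ∀ f → InReg* f →
  ¬ (∀ x y d → op (fn f x y) d ∼ fn f (op x d) (op y d))
no-Reg*-choice-commutes {op} rel f (_<_ , sto , reg , f≗min) commute =
  no-regular-monotone-order rel sto reg (commutes-with-min⇒Monotone sto λ x y d →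
    subst₂ _∼_ (cong (λ z → op z d) (f≗min x y)) (f≗min _ _) (commute x y d))

embed : Sen → SenS
embed (atom n) = atom n
embed (¬' α)   = ¬' embed α
embed (α ∧' β) = embed α ∧' embed β

bar-embed : ∀ f α → bar f (embed α) ≡ α
bar-embed f (atom n) = refl
bar-embed f (¬' α)   = cong ¬'_ (bar-embed f α)
bar-embed f (α ∧' β) = cong₂ _∧'_ (bar-embed f α) (bar-embed f β)

DistScheme : (SenS → SenS → SenS) → SenS → SenS → SenS → SenS
DistScheme _⋆s_ φ ψ σ = (φ ⋆s (ψ ∣ σ)) ↔s ((φ ⋆s ψ) ∣ (φ ⋆s σ))

DistScheme⇒commutes : ∀ {X f} (_⋆s_ : SenS → SenS → SenS) (_⋆_ : Sen → Sen → Sen) →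
  (∀ φ ψ → bar f (φ ⋆s ψ) ≡ bar f φ ⋆ bar f ψ) →
  SchemeTautX X (DistScheme _⋆s_) → X f → ∀ c x y → (c ⋆ fn f x y) ∼ fn f (c ⋆ x) (c ⋆ y)
DistScheme⇒commutes {f = f} _⋆s_ _⋆_ bar-⋆ taut Xf c x y =
  subst₂ _∼_ bar-lhs bar-rhs λ M → ↔'-sound (bar f lhs) (bar f rhs) M (taut (embed c) (embed x) (embed y) M f Xf)
  where
  lhs rhs : SenS
  lhs = embed c ⋆s (embed x ∣ embed y)
  rhs = (embed c ⋆s embed x) ∣ (embed c ⋆s embed y)

  bar-⋆-embed : ∀ α β → bar f (embed α ⋆s embed β) ≡ α ⋆ β
  bar-⋆-embed α β = trans (bar-⋆ (embed α) (embed β)) (cong₂ _⋆_ (bar-embed f α) (bar-embed f β))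

  bar-lhs : bar f lhs ≡ c ⋆ fn f x y
  bar-lhs = trans (bar-⋆ (embed c) (embed x ∣ embed y))
                  (cong₂ _⋆_ (bar-embed f c) (cong₂ (fn f) (bar-embed f x) (bar-embed f y)))

  bar-rhs : bar f rhs ≡ fn f (c ⋆ x) (c ⋆ y)
  bar-rhs = cong₂ (fn f) (bar-⋆-embed c x) (bar-⋆-embed c y)

proposition2p38 :
    (¬ Σ (Rel Sen _) (λ _<_ → IsTotalOrdering _<_ × Regular _<_ × ∧-Monotonic _<_))
    × (¬ Σ (Rel Sen _) (λ _<_ → IsTotalOrdering _<_ × Regular _<_ × ∨-Monotonic _<_))
    × (¬ Σ (ChoiceFn → Set₁) (λ X → NonemptySubReg* X × SchemeTautX X ∧-distScheme))
    × (¬ Σ (ChoiceFn → Set₁) (λ X → NonemptySubReg* X × SchemeTautX X ∨-distScheme))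
proposition2p38 =
    (λ (_<_ , sto , reg , mono) → no-regular-monotone-order ∧-relativisation sto reg
       λ x y d distinct → Equivalence.to (mono x y d distinct))
  , (λ (_<_ , sto , reg , mono) → no-regular-monotone-order ∨¬-relativisation sto reg
       λ x y d distinct → Equivalence.to (mono x y (¬' d) distinct))
  , (λ (X , ((f , Xf) , X⊆Reg*) , taut) → no-Reg*-choice-commutes ∧-relativisationˡ f (X⊆Reg* f Xf)
       λ x y d → DistScheme⇒commutes _∧'_ _∧'_ (λ _ _ → refl) taut Xf d x y)
  , (λ (X , ((f , Xf) , X⊆Reg*) , taut) → no-Reg*-choice-commutes ∨¬-relativisationˡ f (X⊆Reg* f Xf)
       λ x y d → DistScheme⇒commutes _∨s_ _∨'_ (λ _ _ → refl) taut Xf (¬' d) x y)
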